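{- Let $G$ be a graph. If $G$ has a $c$-deletion set of size at most $k$, then the set $D_G^{k+c}=\{v\in V(G):\deg_G(v)\ge k+c\}$ is a $kc(k+c)$-deletion set of $G$ of size at most $k$. Furthermore, every subset $D\subseteq D_G^{k+c}$ is a $(k-|D|,c)$-extended deletion set of $G$.
   Context: A $c$-deletion set of $G$ is a set $S\subseteq V(G)$ such that every connected component of $G\setminus S$ has at most $c$ vertices. A $(k,c)$-extended deletion set of $G$ is a set $D\subseteq V(G)$ such that every component of $G\setminus D$ either has at most $c$ vertices or has a $c$-deletion set of size at most $k$, and at most $k$ components of $G\setminus D$ have more than $c$ vertices. -}

module Defs where

open import Data.Nat using (ℕ; suc; _≤_; _<_; _≤?_)
open import Data.Fin using (Fin)
open import Data.Fin.Subset using (Subset; _∈_; _∉_; ∣_∣)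
open import Data.Vec using (tabulate)
open import Data.List using (List; length; filter; allFin)
open import Data.List.Relation.Unary.All using (All)
open import Data.List.Relation.Unary.AllPairs using (AllPairs)
open import Data.List.Relation.Unary.Unique.Propositional using (Unique)
open import Data.Product using (Σ; _×_)
open import Data.Sum using (_⊎_)
open import Data.Unit using (⊤)
open import Relation.Nullary using (¬_; does)
open import Relation.Unary using (Pred)
import Relation.Binary as B
open import Level using (0ℓ)

record Graph (n : ℕ) : Set₁ where
  field
    Adj    : Fin n → Fin n → Set
    adj?   : B.Decidable Adj
    sym    : ∀ {u v} → Adj u v → Adj v u
    irrefl : ∀ v → ¬ Adj v v
open Graph public

deg : ∀ {n} → Graph n → Fin n → ℕ
deg G v = length (filter (adj? G v) (allFin _))

highDeg : ∀ {n} → Graph n → ℕ → Subset n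
highDeg G d = tabulate (λ v → does (d ≤? deg G v))

-- Reach G A u v : v is reachable from u by a path all of whose vertices
-- lie in A, i.e. v is in the connected component of u in G[A] (and u ∈ A).
data Reach {n} (G : Graph n) (A : Pred (Fin n) 0ℓ) : Fin n → Fin n → Set where
  here : ∀ {u} → A u → Reach G A u u
  step : ∀ {u w v} → A u → Adj G u w → Reach G A w v → Reach G A u v

AtMost : ∀ {n} → ℕ → Pred (Fin n) 0ℓ → Set
AtMost {n} c P = (xs : List (Fin n)) → Unique xs → All P xs → length xs ≤ c

MoreThan : ∀ {n} → ℕ → Pred (Fin n) 0ℓ → Set
MoreThan {n} c P = Σ (List (Fin n)) λ xs → Unique xs × All P xs × c < length xs

-- S is a c-deletion set of the induced subgraph G[A]:
-- S ⊆ A and every connected component of G[A] ∖ S has at most c vertices.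
IsDelSetIn : ∀ {n} → Graph n → Pred (Fin n) 0ℓ → ℕ → Subset n → Set
IsDelSetIn G A c S =
  (∀ v → v ∈ S → A v) ×
  (∀ v → A v → v ∉ S → AtMost c (Reach G (λ u → A u × u ∉ S) v))

IsDelSet : ∀ {n} → Graph n → ℕ → Subset n → Set
IsDelSet G c S = IsDelSetIn G (λ _ → ⊤) c S

-- D is a (k,c)-extended deletion set of G: every component of G ∖ D
-- either has at most c vertices or (as a graph) has a c-deletion set of
-- size at most k, and at most k components of G ∖ D have more than c
-- vertices (any family of vertices lying in pairwise distinct large
-- components has at most k members).
IsExtDelSet : ∀ {n} → Graph n → ℕ → ℕ → Subset n → Set
IsExtDelSet {n} G k c D =
  (∀ v → v ∉ D →
     AtMost c (Reach G Out v)
     ⊎ Σ (Subset n) (λ S → ∣ S ∣ ≤ k × IsDelSetIn G (Reach G Out v) c S))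
  ×
  ((xs : List (Fin n)) →
     All (λ v → v ∉ D × MoreThan c (Reach G Out v)) xs →
     AllPairs (λ u w → ¬ Reach G Out u w) xs →
     length xs ≤ k)
  where
    Out : Pred (Fin n) 0ℓ
    Out u = u ∉ D

{-# OPTIONS --safe #-}
-- Let S be a c-deletion set with |S| ≤ k. A vertex outside S has at most k
-- neighbours in S and fewer than c outside it (they share its component of
-- G ∖ S), so D_G^{k+c} ⊆ S. Hence for D ⊆ D_G^{k+c} the vertices of S in a
-- component of G ∖ D form a c-deletion set of it, and every component with
-- more than c vertices contains its own vertex of S ∖ D; both are bounded by
-- |S ∖ D| ≤ k − |D|. A component of G ∖ D_G^{k+c} without a vertex of S has
-- at most c vertices; one with such a vertex is covered by S and the
-- components of G ∖ S at the neighbours of the vertices of S of degree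
-- < k + c, so it has at most |S| + |S|(k + c − 1)c ≤ kc(k + c) vertices.
module Submission where

open import Defs
open import Data.Empty using (⊥-elim)
open import Data.Fin using (Fin; zero; suc; _≟_)
open import Data.Fin.Properties using (any?; suc-injective)
open import Data.Fin.Subset using (Subset; _∈_; _∉_; ∣_∣; _⊆_; _⊂_; _-_; ⁅_⁆; inside; outside)
open import Data.Fin.Subset.Properties
  using (_∈?_; p⊆q⇒∣p∣≤∣q∣; p─q⊆p; x∈p∧x≢y⇒x∈p-y; x∈p⇒p-x⊂p; x∈p⇒∣p-x∣<∣p∣)
open import Data.Fin.Subset.Induction using (⊂-wellFounded)
open import Data.List using (List; []; _∷_; _++_; length; map; filter; concatMap; allFin)
open import Data.List.Properties using (length-map; length-++)
open import Data.List.Membership.Propositional using (lose) renaming (_∈_ to _∈ₗ_)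
open import Data.List.Membership.Propositional.Properties using (∈-filter⁺; ∈-allFin; ∈-map⁺; ∈-concatMap⁺)
open import Data.List.Relation.Unary.All as All using (All; []; _∷_)
import Data.List.Relation.Unary.All.Properties as All
open import Data.List.Relation.Unary.AllPairs as AllPairs using (AllPairs; []; _∷_)
open import Data.List.Relation.Unary.Any using (Any; here; there)
open import Data.List.Relation.Unary.Unique.Propositional using (Unique)
import Data.List.Relation.Unary.Unique.Propositional.Properties as Unique
open import Data.Nat using (ℕ; _≤_; _<_; _+_; _*_; _∸_; z≤n; s≤s; _≤?_; >-nonZero)
open import Data.Nat.Properties
  using ( ≤-trans; <⇒≱; ≰⇒>; m≤m+n; +-suc; +-assoc; +-comm; +-mono-≤; +-monoˡ-≤
        ; *-assoc; *-comm; *-monoˡ-≤; *-distribʳ-+; m≤m*n; m≤n*m; ∸-monoˡ-≤; m+n≤o⇒m≤o∸n; module ≤-Reasoning)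
open import Data.Product using (Σ; _×_; _,_; proj₁; proj₂)
open import Data.Sum using (_⊎_; inj₁; inj₂)
open import Data.Unit using (tt)
open import Data.Vec as Vec using ([]; _∷_; tabulate)
open import Data.Vec.Properties using ([]=⇒lookup; lookup⇒[]=; lookup∘tabulate)
open import Function using (_∘_)
open import Induction.WellFounded using (Acc; acc)
open import Level using (0ℓ)
open import Relation.Binary.PropositionalEquality using (_≡_; _≢_; refl; cong; subst; trans) renaming (sym to ≡-sym)
open import Relation.Nullary using (¬_; Dec; yes; no; does; _×-dec_)
open import Relation.Nullary.Decidable using (map′; dec-true)
open import Relation.Unary using (Pred; Decidable)
open import Relation.Unary.Properties using (∁?)

length-filter+filter-∁ : ∀ {A : Set} {P : Pred A 0ℓ} (P? : Decidable P) (xs : List A) →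
  length xs ≡ length (filter P? xs) + length (filter (∁? P?) xs)
length-filter+filter-∁ P? [] = refl
length-filter+filter-∁ P? (x ∷ xs) with P? x
... | yes _ = cong ℕ.suc (length-filter+filter-∁ P? xs)
... | no _ = trans (cong ℕ.suc (length-filter+filter-∁ P? xs)) (≡-sym (+-suc _ _))

length-concatMap< : ∀ {A B : Set} {f : A → List B} {m} → (∀ x → length (f x) < m) →
  ∀ xs → length (concatMap f xs) + length xs ≤ length xs * m
length-concatMap< bound [] = z≤n
length-concatMap< {f = f} {m} bound (x ∷ xs) = begin
  length (f x ++ concatMap f xs) + ℕ.suc (length xs)
    ≡⟨ cong (_+ ℕ.suc (length xs)) (length-++ (f x)) ⟩
  length (f x) + length (concatMap f xs) + ℕ.suc (length xs)
    ≡⟨ trans (+-suc _ _) (cong ℕ.suc (+-assoc (length (f x)) _ _)) ⟩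
  ℕ.suc (length (f x)) + (length (concatMap f xs) + length xs)
    ≤⟨ +-mono-≤ (bound x) (length-concatMap< bound xs) ⟩
  m + length xs * m ∎
  where open ≤-Reasoning

module _ {n : ℕ} where

  fromDec : {P : Pred (Fin n) 0ℓ} → Decidable P → Subset n
  fromDec P? = tabulate (λ x → does (P? x))

  ∈-fromDec⁺ : {P : Pred (Fin n) 0ℓ} (P? : Decidable P) → ∀ {x} → P x → x ∈ fromDec P?
  ∈-fromDec⁺ P? {x} px = lookup⇒[]= x _ (trans (lookup∘tabulate _ x) (dec-true (P? x) px))

  ∈-fromDec⁻ : {P : Pred (Fin n) 0ℓ} (P? : Decidable P) → ∀ {x} → x ∈ fromDec P? → P x
  ∈-fromDec⁻ P? {x} x∈ with P? x | trans (≡-sym (lookup∘tabulate _ x)) ([]=⇒lookup x∈)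
  ... | yes px | _  = px
  ... | no _   | ()

elements : ∀ {n} → Subset n → List (Fin n)
elements []            = []
elements (inside ∷ p)  = zero ∷ map suc (elements p)
elements (outside ∷ p) = map suc (elements p)

length-elements : ∀ {n} (p : Subset n) → length (elements p) ≡ ∣ p ∣
length-elements []            = refl
length-elements (inside ∷ p)  = cong ℕ.suc (trans (length-map suc (elements p)) (length-elements p))
length-elements (outside ∷ p) = trans (length-map suc (elements p)) (length-elements p)

elements-⊆ : ∀ {n} (p : Subset n) → All (_∈ p) (elements p)
elements-⊆ []            = []
elements-⊆ (inside ∷ p)  = Vec.here ∷ All.map⁺ (All.map Vec.there (elements-⊆ p))
elements-⊆ (outside ∷ p) = All.map⁺ (All.map Vec.there (elements-⊆ p))

∈-elements : ∀ {n} {p : Subset n} {x} → x ∈ p → x ∈ₗ elements p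
∈-elements {p = inside ∷ p}  Vec.here      = here refl
∈-elements {p = inside ∷ p}  (Vec.there m) = there (∈-map⁺ suc (∈-elements m))
∈-elements {p = outside ∷ p} (Vec.there m) = ∈-map⁺ suc (∈-elements m)

elements-unique : ∀ {n} (p : Subset n) → Unique (elements p)
elements-unique []            = []
elements-unique (inside ∷ p)  = All.map⁺ (All.tabulate (λ _ ())) ∷ Unique.map⁺ suc-injective (elements-unique p)
elements-unique (outside ∷ p) = Unique.map⁺ suc-injective (elements-unique p)

module _ {n : ℕ} where

  AtMost-mono : ∀ {P Q : Pred (Fin n) 0ℓ} {m} → (∀ {x} → P x → Q x) → AtMost m Q → AtMost m P
  AtMost-mono P⊆Q am xs u ps = am xs u (All.map P⊆Q ps)

  AtMost-≤ : ∀ {P : Pred (Fin n) 0ℓ} {a b} → a ≤ b → AtMost a P → AtMost b P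
  AtMost-≤ a≤b am xs u ps = ≤-trans (am xs u ps) a≤b

  AtMost-⊎ : ∀ {P Q : Pred (Fin n) 0ℓ} {a b} → Decidable P → AtMost a P → AtMost b Q →
             AtMost (a + b) (λ x → P x ⊎ Q x)
  AtMost-⊎ {P} {Q} {a} {b} P? amP amQ xs u ps = begin
    length xs                                            ≡⟨ length-filter+filter-∁ P? xs ⟩
    length (filter P? xs) + length (filter (∁? P?) xs)   ≤⟨ +-mono-≤ inP inQ ⟩
    a + b                                                ∎
    where
    open ≤-Reasoning
    inP : length (filter P? xs) ≤ a
    inP = amP _ (Unique.filter⁺ P? u) (All.all-filter P? xs)
    resolve : ∀ {x} → ¬ P x × (P x ⊎ Q x) → Q x
    resolve (¬p , inj₁ p) = ⊥-elim (¬p p)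
    resolve (_ , inj₂ q)  = q
    inQ : length (filter (∁? P?) xs) ≤ b
    inQ = amQ _ (Unique.filter⁺ (∁? P?) u)
              (All.map resolve (All.zip (All.all-filter (∁? P?) xs , All.filter⁺ (∁? P?) ps)))

  AtMost-Any : ∀ {P : Fin n → Pred (Fin n) 0ℓ} {m} → (∀ w → Decidable (P w)) → (∀ w → AtMost m (P w)) →
               ∀ ws → AtMost (length ws * m) (λ x → Any (λ w → P w x) ws)
  AtMost-Any P? am [] []      _ _        = z≤n
  AtMost-Any P? am [] (_ ∷ _) _ (() ∷ _)
  AtMost-Any {P} P? am (w ∷ ws) = AtMost-mono split (AtMost-⊎ (P? w) (am w) (AtMost-Any P? am ws))
    where
    split : ∀ {x} → Any (λ w → P w x) (w ∷ ws) → P w x ⊎ Any (λ w → P w x) ws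
    split (here p)  = inj₁ p
    split (there a) = inj₂ a

  AtMost-∈ : (p : Subset n) → AtMost ∣ p ∣ (_∈ p)
  AtMost-∈ p []       _              _            = z≤n
  AtMost-∈ p (x ∷ xs) (x∉xs ∷ u) (x∈p ∷ xs⊆p) =
    ≤-trans (s≤s (AtMost-∈ (p - x) xs u (All.zipWith move (xs⊆p , x∉xs)))) (x∈p⇒∣p-x∣<∣p∣ x∈p)
    where
    move : ∀ {y} → y ∈ p × x ≢ y → y ∈ p - x
    move (y∈p , x≢y) = x∈p∧x≢y⇒x∈p-y y∈p (x≢y ∘ ≡-sym)

  AtMost-∈∖ : ∀ {p q} → q ⊆ p → AtMost (∣ p ∣ ∸ ∣ q ∣) (λ x → x ∈ p × x ∉ q)
  AtMost-∈∖ {p} {q} q⊆p xs u ps = m+n≤o⇒m≤o∸n (length xs) (begin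
    length xs + ∣ q ∣               ≡⟨ cong (length xs +_) (≡-sym (length-elements q)) ⟩
    length xs + length (elements q) ≡⟨ ≡-sym (length-++ xs) ⟩
    length (xs ++ elements q)       ≤⟨ AtMost-∈ p _ (Unique.++⁺ u (elements-unique q) disjoint)
                                         (All.++⁺ (All.map proj₁ ps) (All.map q⊆p (elements-⊆ q))) ⟩
    ∣ p ∣                           ∎)
    where
    open ≤-Reasoning
    disjoint : ∀ {v} → ¬ (v ∈ₗ xs × v ∈ₗ elements q)
    disjoint (v∈xs , v∈q) = proj₂ (All.lookup ps v∈xs) (All.lookup (elements-⊆ q) v∈q)

  AtMost⇒∣p∣≤ : ∀ {m} (p : Subset n) → AtMost m (_∈ p) → ∣ p ∣ ≤ m
  AtMost⇒∣p∣≤ {m} p am = subst (_≤ m) (length-elements p) (am _ (elements-unique p) (elements-⊆ p))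

  AtMost-witnesses : ∀ {A : Set} {T : Pred (Fin n) 0ℓ} {Q : A → Fin n → Set} {m} → AtMost m T →
    (xs : List A) → All (λ x → Σ (Fin n) λ s → T s × Q x s) xs →
    AllPairs (λ x y → ∀ {s} → Q x s → ¬ Q y s) xs → length xs ≤ m
  AtMost-witnesses {A} {T} {Q} {m} am xs ws apart =
    let ss , u , ts , len , _ = choose xs ws apart in subst (_≤ m) len (am ss u ts)
    where
    choose : ∀ xs → All (λ x → Σ (Fin n) λ s → T s × Q x s) xs →
             AllPairs (λ x y → ∀ {s} → Q x s → ¬ Q y s) xs →
             Σ (List (Fin n)) λ ss → Unique ss × All T ss × length ss ≡ length xs
                                     × All (λ s → Any (λ x → Q x s) xs) ss
    choose [] [] [] = [] , [] , [] , refl , []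
    choose (x ∷ xs) ((s , t , q) ∷ ws) (x-apart ∷ apart) with choose xs ws apart
    ... | ss , u , ts , len , hits =
      s ∷ ss , All.map fresh hits ∷ u , t ∷ ts , cong ℕ.suc len , here q ∷ All.map there hits
      where
      fresh : ∀ {s′} → Any (λ y → Q y s′) xs → s ≢ s′
      fresh hit refl = All.All¬⇒¬Any (All.map (λ apart-y → apart-y q) x-apart) hit

module _ {n : ℕ} (G : Graph n) where

  neighbours : Fin n → List (Fin n)
  neighbours v = filter (adj? G v) (allFin n)

  neighbours-unique : ∀ v → Unique (neighbours v)
  neighbours-unique v = Unique.filter⁺ (adj? G v) (Unique.allFin⁺ n)

  neighbours-adj : ∀ v → All (Adj G v) (neighbours v)
  neighbours-adj v = All.all-filter (adj? G v) (allFin n)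

  ∈-neighbours : ∀ {v w} → Adj G v w → w ∈ₗ neighbours v
  ∈-neighbours {v} = ∈-filter⁺ (adj? G v) (∈-allFin _)

  Reach-start : ∀ {P u v} → Reach G P u v → P u
  Reach-start (here pu)     = pu
  Reach-start (step pu _ _) = pu

  Reach-end : ∀ {P u v} → Reach G P u v → P v
  Reach-end (here pv)    = pv
  Reach-end (step _ _ r) = Reach-end r

  Reach-map : ∀ {P Q : Pred (Fin n) 0ℓ} {u v} → (∀ {x} → P x → Q x) → Reach G P u v → Reach G Q u v
  Reach-map f (here pu)      = here (f pu)
  Reach-map f (step pu uw r) = step (f pu) uw (Reach-map f r)

  Reach-trans : ∀ {P u w v} → Reach G P u w → Reach G P w v → Reach G P u v
  Reach-trans (here _)        r = r
  Reach-trans (step pu uw r′) r = step pu uw (Reach-trans r′ r)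

  Reach-sym : ∀ {P u v} → Reach G P u v → Reach G P v u
  Reach-sym (here pu)      = here pu
  Reach-sym (step pu uw r) = Reach-trans (Reach-sym r) (step (Reach-start r) (Graph.sym G uw) (here pu))

  -- The second alternative is the part of the path after its last visit to u.
  Reach-avoids⊎leaves : ∀ {P x v} u → Reach G P x v → v ≢ u →
    Reach G (λ y → P y × y ≢ u) x v ⊎ Σ (Fin n) λ w → Adj G u w × Reach G (λ y → P y × y ≢ u) w v
  Reach-avoids⊎leaves u (here pv) v≢u = inj₁ (here (pv , v≢u))
  Reach-avoids⊎leaves {x = x} u (step {w = w} px xw r) v≢u with Reach-avoids⊎leaves u r v≢u | x ≟ u
  ... | inj₁ r′ | yes refl = inj₂ (w , xw , r′)
  ... | inj₁ r′ | no x≢u   = inj₁ (step (px , x≢u) xw r′)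
  ... | inj₂ l  | _        = inj₂ l

  reach∈? : ∀ {A} → Acc _⊂_ A → ∀ u v → Dec (Reach G (_∈ A) u v)
  reach∈? {A} (acc smaller) u v with u ∈? A | u ≟ v
  ... | no u∉A  | _        = no (u∉A ∘ Reach-start)
  ... | yes u∈A | yes refl = yes (here u∈A)
  ... | yes u∈A | no u≢v   =
    map′ enter leave (any? (λ w → adj? G u w ×-dec reach∈? (smaller (x∈p⇒p-x⊂p u∈A)) w v))
    where
    enter : Σ (Fin n) (λ w → Adj G u w × Reach G (_∈ A - u) w v) → Reach G (_∈ A) u v
    enter (w , uw , r) = step u∈A uw (Reach-map (p─q⊆p A ⁅ u ⁆) r)
    leave : Reach G (_∈ A) u v → Σ (Fin n) (λ w → Adj G u w × Reach G (_∈ A - u) w v)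
    leave r with Reach-avoids⊎leaves u r (u≢v ∘ ≡-sym)
    ... | inj₁ r′           = ⊥-elim (proj₂ (Reach-start r′) refl)
    ... | inj₂ (w , uw , r′) = w , uw , Reach-map (λ (y∈A , y≢u) → x∈p∧x≢y⇒x∈p-y y∈A y≢u) r′

  reach? : ∀ {P : Pred (Fin n) 0ℓ} → Decidable P → ∀ u v → Dec (Reach G P u v)
  reach? P? u v =
    map′ (Reach-map (∈-fromDec⁻ P?)) (Reach-map (∈-fromDec⁺ P?)) (reach∈? (⊂-wellFounded (fromDec P?)) u v)

  Reach-avoids⊎hits : ∀ {P} S {v x} → Reach G P v x →
    Reach G (λ u → P u × u ∉ S) v x ⊎ Σ (Fin n) λ s → s ∈ S × Reach G P v s
  Reach-avoids⊎hits S {v} r with v ∈? S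
  Reach-avoids⊎hits S (here pv)       | yes v∈S = inj₂ (_ , v∈S , here pv)
  Reach-avoids⊎hits S (step pv vw r)  | yes v∈S = inj₂ (_ , v∈S , here pv)
  Reach-avoids⊎hits S (here pv)       | no v∉S  = inj₁ (here (pv , v∉S))
  Reach-avoids⊎hits S (step pv vw r)  | no v∉S with Reach-avoids⊎hits S r
  ... | inj₁ r′             = inj₁ (step (pv , v∉S) vw r′)
  ... | inj₂ (s , s∈S , r′) = inj₂ (s , s∈S , step pv vw r′)

  All-Reach-avoids⊎hits : ∀ {P} S {v xs} → All (Reach G P v) xs →
    All (Reach G (λ u → P u × u ∉ S) v) xs ⊎ Σ (Fin n) λ s → s ∈ S × Reach G P v s
  All-Reach-avoids⊎hits S [] = inj₁ []
  All-Reach-avoids⊎hits S (r ∷ rs) with Reach-avoids⊎hits S r | All-Reach-avoids⊎hits S rs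
  ... | inj₂ hit | _        = inj₂ hit
  ... | inj₁ _   | inj₂ hit = inj₂ hit
  ... | inj₁ r′  | inj₁ rs′ = inj₁ (r′ ∷ rs′)

  Reach-exit : ∀ {P} S {x y} → Reach G P x y → x ∉ S → y ∈ S →
    Σ (Fin n) λ w → Σ (Fin n) λ s → Reach G (λ u → P u × u ∉ S) x w × Adj G w s × s ∈ S × P s
  Reach-exit S (here _) x∉S x∈S = ⊥-elim (x∉S x∈S)
  Reach-exit S {x} (step {w = z} px xz r) x∉S y∈S with z ∈? S
  ... | yes z∈S = x , z , here (px , x∉S) , xz , z∈S , Reach-start r
  ... | no z∉S  =
    let w , s , z⇝w , ws , s∈S , ps = Reach-exit S r z∉S y∈S
    in w , s , step (px , x∉S) xz z⇝w , ws , s∈S , ps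

module HighDegree {n} (G : Graph n) (k c : ℕ) (1≤k : 1 ≤ k) (1≤c : 1 ≤ c)
                  (S : Subset n) (∣S∣≤k : ∣ S ∣ ≤ k) (S-deletes : IsDelSet G c S) where

  H : Subset n
  H = highDeg G (k + c)

  0<k+c : 0 < k + c
  0<k+c = ≤-trans 1≤k (m≤m+n k c)

  G∖S-component-small : ∀ v → AtMost c (Reach G (_∉ S) v)
  G∖S-component-small v []           _ _        = z≤n
  G∖S-component-small v xs@(_ ∷ _) u rs@(r ∷ _) =
    AtMost-mono (Reach-map G (tt ,_)) (proj₂ S-deletes v tt (Reach-start G r)) xs u rs

  ∉S⇒deg<k+c : ∀ {v} → v ∉ S → deg G v < k + c
  ∉S⇒deg<k+c {v} v∉S =
    AtMost-⊎ (_∈? S) (AtMost-≤ ∣S∣≤k (AtMost-∈ S)) (G∖S-component-small v) (v ∷ neighbours G v)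
      (All.map (λ vw v≡w → irrefl G v (subst (Adj G v) (≡-sym v≡w) vw)) (neighbours-adj G v)
         ∷ neighbours-unique G v)
      (inj₂ (here v∉S) ∷ All.map classify (neighbours-adj G v))
    where
    classify : ∀ {w} → Adj G v w → w ∈ S ⊎ Reach G (_∉ S) v w
    classify {w} vw with w ∈? S
    ... | yes w∈S = inj₁ w∈S
    ... | no w∉S  = inj₂ (step v∉S vw (here w∉S))

  ∉H⇒deg<k+c : ∀ {v} → v ∉ H → deg G v < k + c
  ∉H⇒deg<k+c v∉H = ≰⇒> (v∉H ∘ ∈-fromDec⁺ (λ v → k + c ≤? deg G v))

  H⊆S : H ⊆ S
  H⊆S {v} v∈H with v ∈? S
  ... | yes v∈S = v∈S
  ... | no v∉S  = ⊥-elim (<⇒≱ (∉S⇒deg<k+c v∉S) (∈-fromDec⁻ (λ v → k + c ≤? deg G v) v∈H))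

  ∣H∣≤k : ∣ H ∣ ≤ k
  ∣H∣≤k = ≤-trans (p⊆q⇒∣p∣≤∣q∣ H⊆S) ∣S∣≤k

  small⊎meets-S : ∀ {P v} xs → Unique xs → All (Reach G P v) xs →
                  length xs ≤ c ⊎ Σ (Fin n) λ s → s ∈ S × Reach G P v s
  small⊎meets-S [] _ _ = inj₁ z≤n
  small⊎meets-S {v = v} xs@(_ ∷ _) u rs with All-Reach-avoids⊎hits G S rs
  ... | inj₂ hit         = inj₂ hit
  ... | inj₁ rs′@(_ ∷ _) = inj₁ (G∖S-component-small v xs u (All.map (Reach-map G proj₂) rs′))

  large⇒meets-S : ∀ {P v} → MoreThan c (Reach G P v) → Σ (Fin n) λ s → s ∈ S × Reach G P v s
  large⇒meets-S (xs , u , rs , c<) with small⊎meets-S xs u rs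
  ... | inj₁ ≤c  = ⊥-elim (<⇒≱ c< ≤c)
  ... | inj₂ hit = hit

  -- Vertices of H are deleted, so a path in G ∖ H never leaves S through them.
  exits : Fin n → List (Fin n)
  exits s with s ∈? H
  ... | yes _ = []
  ... | no _  = neighbours G s

  frontier : List (Fin n)
  frontier = concatMap exits (elements S)

  ∈-frontier : ∀ {s w} → s ∈ S → s ∉ H → Adj G s w → w ∈ₗ frontier
  ∈-frontier {s} s∈S s∉H sw = ∈-concatMap⁺ exits (lose (∈-elements s∈S) ∈-exits)
    where
    ∈-exits : _ ∈ₗ exits s
    ∈-exits with s ∈? H
    ... | yes s∈H = ⊥-elim (s∉H s∈H)
    ... | no _    = ∈-neighbours G sw

  length-frontier : length frontier + ∣ S ∣ ≤ ∣ S ∣ * (k + c)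
  length-frontier = subst (λ t → length frontier + t ≤ t * (k + c)) (length-elements S)
                          (length-concatMap< length-exits (elements S))
    where
    length-exits : ∀ s → length (exits s) < k + c
    length-exits s with s ∈? H
    ... | yes _   = 0<k+c
    ... | no s∉H  = ∉H⇒deg<k+c s∉H

  ∣S∣+∣frontier∣*c≤k*c*[k+c] : ∣ S ∣ + length frontier * c ≤ k * c * (k + c)
  ∣S∣+∣frontier∣*c≤k*c*[k+c] = begin
    ∣ S ∣ + length frontier * c     ≤⟨ +-monoˡ-≤ _ (m≤m*n ∣ S ∣ c {{>-nonZero 1≤c}}) ⟩
    ∣ S ∣ * c + length frontier * c ≡⟨ ≡-sym (*-distribʳ-+ c ∣ S ∣ _) ⟩
    (∣ S ∣ + length frontier) * c   ≡⟨ cong (_* c) (+-comm ∣ S ∣ _) ⟩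
    (length frontier + ∣ S ∣) * c   ≤⟨ *-monoˡ-≤ c (≤-trans length-frontier (*-monoˡ-≤ (k + c) ∣S∣≤k)) ⟩
    k * (k + c) * c                 ≡⟨ *-assoc k (k + c) c ⟩
    k * ((k + c) * c)               ≡⟨ cong (k *_) (*-comm (k + c) c) ⟩
    k * (c * (k + c))               ≡⟨ ≡-sym (*-assoc k c (k + c)) ⟩
    k * c * (k + c)                 ∎
    where open ≤-Reasoning

  c≤k*c*[k+c] : c ≤ k * c * (k + c)
  c≤k*c*[k+c] = ≤-trans (m≤n*m c k {{>-nonZero 1≤k}}) (m≤m*n (k * c) (k + c) {{>-nonZero 0<k+c}})

  meeting-component-bounded : ∀ {v s₀} → s₀ ∈ S → Reach G (_∉ H) v s₀ →
                              AtMost (k * c * (k + c)) (Reach G (_∉ H) v)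
  meeting-component-bounded {v} s₀∈S v⇝s₀ =
    AtMost-≤ ∣S∣+∣frontier∣*c≤k*c*[k+c]
      (AtMost-mono classify
        (AtMost-⊎ (_∈? S) (AtMost-∈ S) (AtMost-Any (reach? G (∁? (_∈? S))) G∖S-component-small frontier)))
    where
    classify : ∀ {x} → Reach G (_∉ H) v x → x ∈ S ⊎ Any (λ w → Reach G (_∉ S) w x) frontier
    classify {x} v⇝x with x ∈? S
    ... | yes x∈S = inj₁ x∈S
    ... | no x∉S  =
      let w , s , x⇝w , ws , s∈S , s∉H = Reach-exit G S (Reach-trans G (Reach-sym G v⇝x) v⇝s₀) x∉S s₀∈S
      in inj₂ (lose (∈-frontier s∈S s∉H (Graph.sym G ws)) (Reach-sym G (Reach-map G proj₂ x⇝w)))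

  H-deletes : IsDelSet G (k * c * (k + c)) H
  H-deletes = (λ _ _ → tt) , λ v _ _ → AtMost-mono (Reach-map G proj₂) (component-bounded v)
    where
    component-bounded : ∀ v → AtMost (k * c * (k + c)) (Reach G (_∉ H) v)
    component-bounded v xs u rs with small⊎meets-S xs u rs
    ... | inj₁ ≤c                = ≤-trans ≤c c≤k*c*[k+c]
    ... | inj₂ (_ , s₀∈S , v⇝s₀) = meeting-component-bounded s₀∈S v⇝s₀ xs u rs

  module _ (D : Subset n) (D⊆H : D ⊆ H) where

    S∖D-bounded : AtMost (k ∸ ∣ D ∣) (λ s → s ∈ S × s ∉ D)
    S∖D-bounded = AtMost-≤ (∸-monoˡ-≤ ∣ D ∣ ∣S∣≤k) (AtMost-∈∖ (H⊆S ∘ D⊆H))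

    component-deletion-set : ∀ v →
      Σ (Subset n) λ S′ → ∣ S′ ∣ ≤ k ∸ ∣ D ∣ × IsDelSetIn G (Reach G (_∉ D) v) c S′
    component-deletion-set v =
      S′ , AtMost⇒∣p∣≤ S′ (AtMost-mono S′⊆S∖D S∖D-bounded)
         , (λ _ → proj₂ ∘ ∈S′⁻)
         , (λ w _ _ → AtMost-mono (Reach-map G outside-S) (G∖S-component-small w))
      where
      S′? : Decidable (λ w → w ∈ S × Reach G (_∉ D) v w)
      S′? w = (w ∈? S) ×-dec reach? G (∁? (_∈? D)) v w
      S′ : Subset n
      S′ = fromDec S′?
      ∈S′⁻ : ∀ {w} → w ∈ S′ → w ∈ S × Reach G (_∉ D) v w
      ∈S′⁻ = ∈-fromDec⁻ S′?
      S′⊆S∖D : ∀ {w} → w ∈ S′ → w ∈ S × w ∉ D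
      S′⊆S∖D w∈S′ = let w∈S , v⇝w = ∈S′⁻ w∈S′ in w∈S , Reach-end G v⇝w
      outside-S : ∀ {u} → Reach G (_∉ D) v u × u ∉ S′ → u ∉ S
      outside-S (v⇝u , u∉S′) u∈S = u∉S′ (∈-fromDec⁺ S′? (u∈S , v⇝u))

    large-components-bounded : (xs : List (Fin n)) →
      All (λ v → v ∉ D × MoreThan c (Reach G (_∉ D) v)) xs →
      AllPairs (λ u w → ¬ Reach G (_∉ D) u w) xs → length xs ≤ k ∸ ∣ D ∣
    large-components-bounded xs larges apart =
      AtMost-witnesses S∖D-bounded xs (All.map witness larges) (AllPairs.map disjoint apart)
      where
      witness : ∀ {v} → v ∉ D × MoreThan c (Reach G (_∉ D) v) →
                Σ (Fin n) λ s → (s ∈ S × s ∉ D) × Reach G (_∉ D) v s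
      witness (_ , large) = let s , s∈S , v⇝s = large⇒meets-S large in s , (s∈S , Reach-end G v⇝s) , v⇝s
      disjoint : ∀ {u w} → ¬ Reach G (_∉ D) u w → ∀ {s} → Reach G (_∉ D) u s → ¬ Reach G (_∉ D) w s
      disjoint ¬u⇝w u⇝s w⇝s = ¬u⇝w (Reach-trans G u⇝s (Reach-sym G w⇝s))

    extended-deletion-set : IsExtDelSet G (k ∸ ∣ D ∣) c D
    extended-deletion-set = (λ v _ → inj₂ (component-deletion-set v)) , large-components-bounded

lemma8 : ∀ {n} (G : Graph n) (k c : ℕ) → 1 ≤ k → 1 ≤ c →
    Σ (Subset n) (λ S → ∣ S ∣ ≤ k × IsDelSet G c S) →
    (IsDelSet G (k * c * (k + c)) (highDeg G (k + c)) × ∣ highDeg G (k + c) ∣ ≤ k)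
    × (∀ (D : Subset n) → D ⊆ highDeg G (k + c) → IsExtDelSet G (k ∸ ∣ D ∣) c D)
lemma8 G k c 1≤k 1≤c (S , ∣S∣≤k , S-deletes) = (H-deletes , ∣H∣≤k) , extended-deletion-set
  where open HighDegree G k c 1≤k 1≤c S ∣S∣≤k S-deletes
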